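{- Let $G$ be a bipartite graph with a perfect matching $M$, let $S$ be a maximum independent set of $G$, and let $X$ be an independent set with $X\subseteq V(G)-S$ such that the induced subgraph $G[X\cup M(X)]$ is connected. Then the set $X^{1}=X\cup M\big((N(X)\cap S)-M(X)\big)$ is independent, and $G[X^{1}\cup M(X^{1})]$ is connected.
   Context: For $A\subseteq V(G)$, $N(A)=\{v\in V(G):N(v)\cap A\neq\emptyset\}$, and $M(A)$ denotes the set of all vertices matched by the matching $M$ with vertices belonging to $A$. $G[Y]$ is the subgraph induced by $Y$. -}

module Defs where

open import Level using (0ℓ)
open import Data.Nat using (ℕ; _≤_)
open import Data.Fin using (Fin)
open import Data.Fin.Subset using (Subset; _∈_; ∣_∣)
open import Data.Bool using (Bool)
open import Data.Sum using (_⊎_)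
open import Data.Product using (Σ; ∃; _×_; _,_)
open import Relation.Nullary using (¬_)
open import Relation.Unary using (Pred)
open import Relation.Binary.PropositionalEquality using (_≡_; _≢_)

record Graph (n : ℕ) : Set₁ where
  field
    Adj     : Fin n → Fin n → Set
    symAdj  : ∀ {u v} → Adj u v → Adj v u
    irrefl  : ∀ {v} → ¬ Adj v v
open Graph public

VSet : ℕ → Set₁
VSet n = Pred (Fin n) 0ℓ

Bipartite : ∀ {n} → Graph n → Set
Bipartite {n} G = Σ (Fin n → Bool) λ c → ∀ u v → Adj G u v → c u ≢ c v

-- A perfect matching, given by the partner map: every vertex v is matched
-- to partner v, which is adjacent to v, and matching is symmetric.
-- (Irreflexivity of Adj makes partner fixed-point free.)
record PerfectMatching {n} (G : Graph n) : Set where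
  field
    partner       : Fin n → Fin n
    partner-adj   : ∀ v → Adj G v (partner v)
    partner-invol : ∀ v → partner (partner v) ≡ v
open PerfectMatching public

Independent : ∀ {n} → Graph n → VSet n → Set
Independent G A = ∀ u v → A u → A v → ¬ Adj G u v

-- Maximum independent set (S given as a finite subset, for cardinality).
MaximumIndependent : ∀ {n} → Graph n → Subset n → Set
MaximumIndependent {n} G S =
  Independent G (_∈ S) × (∀ (T : Subset n) → Independent G (_∈ T) → ∣ T ∣ ≤ ∣ S ∣)

Nbhd : ∀ {n} → Graph n → VSet n → VSet n
Nbhd G A v = ∃ λ a → A a × Adj G v a

Matched : ∀ {n} {G : Graph n} → PerfectMatching G → VSet n → VSet n
Matched M A v = ∃ λ a → A a × v ≡ partner M a

_∪_ : ∀ {n} → VSet n → VSet n → VSet n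
(A ∪ B) v = A v ⊎ B v

_∩_ : ∀ {n} → VSet n → VSet n → VSet n
(A ∩ B) v = A v × B v

_－_ : ∀ {n} → VSet n → VSet n → VSet n
(A － B) v = A v × ¬ B v

data WalkIn {n} (G : Graph n) (Y : VSet n) : Fin n → Fin n → Set where
  here  : ∀ {v} → Y v → WalkIn G Y v v
  step  : ∀ {u w v} → Y u → Adj G u w → WalkIn G Y w v → WalkIn G Y u v

ConnectedInduced : ∀ {n} → Graph n → VSet n → Set
ConnectedInduced G Y = ∀ u v → Y u → Y v → WalkIn G Y u v

X¹ : ∀ {n} {G : Graph n} → PerfectMatching G → Subset n → VSet n → VSet n
X¹ {G = G} M S X = X ∪ Matched M ((Nbhd G X ∩ (_∈ S)) － Matched M X)

-- Since G is bipartite with a perfect matching, one colour class is an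
-- independent set meeting every matching edge; counting matching edges then
-- shows that the maximum independent set S contains exactly one end of each
-- of them, so M(X) ⊆ S. Every edge of G[X ∪ M(X)] therefore joins X to M(X),
-- and connectivity puts all of X in one colour class. The new vertices M(y),
-- y ∈ N(X) ∩ S, have the colour of X as well, so X¹ is independent; and each
-- vertex of X¹ ∪ M(X¹) is joined to X by a walk of length at most two.
module Submission where

open import Defs
open import Data.Nat using (ℕ; zero; suc; _+_; _≤_; _<_; z≤n)
open import Data.Nat.Properties
  using (≤-refl; ≤-trans; <⇒≱; m≤m+n; m≤n+m; +-mono-≤; +-mono-<-≤; +-mono-≤-<; +-0-commutativeMonoid)
open import Data.Fin using (Fin; zero; suc)
open import Data.Fin.Subset using (Subset; _∈_; _∉_; ∣_∣)
open import Data.Fin.Subset.Properties using (_∈?_)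
open import Data.Fin.Permutation using (Permutation; permutation)
open import Data.Bool using (Bool; true; false; if_then_else_)
open import Data.Bool.Properties using (¬-not)
open import Data.Vec using ([]; _∷_; lookup; tabulate)
open import Data.Vec.Properties using ([]=⇒lookup; lookup⇒[]=; lookup∘tabulate)
open import Data.Product using (_×_; _,_; proj₁; proj₂; ∃)
open import Data.Sum using (_⊎_; inj₁; inj₂)
open import Function using (_∘_)
open import Relation.Nullary using (¬_; yes; no; contradiction)
open import Relation.Binary.PropositionalEquality
  using (_≡_; _≢_; refl; sym; trans; cong; cong₂; subst; subst₂; ≢-sym)
open import Algebra.Properties.CommutativeMonoid.Sum +-0-commutativeMonoid
  using (sum; sum-permute; ∑-distrib-+)

≢-≢⇒≡ : {x y z : Bool} → x ≢ y → y ≢ z → x ≡ z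
≢-≢⇒≡ x≢y y≢z = trans (¬-not x≢y) (sym (¬-not (≢-sym y≢z)))

∑-mono-≤ : ∀ {n} (f g : Fin n → ℕ) → (∀ i → f i ≤ g i) → sum f ≤ sum g
∑-mono-≤ {zero}  f g f≤g = z≤n
∑-mono-≤ {suc n} f g f≤g = +-mono-≤ (f≤g zero) (∑-mono-≤ (f ∘ suc) (g ∘ suc) (f≤g ∘ suc))

∑-mono-< : ∀ {n} (f g : Fin n → ℕ) → (∀ i → f i ≤ g i) → ∀ j → f j < g j → sum f < sum g
∑-mono-< {suc n} f g f≤g zero    fj<gj = +-mono-<-≤ fj<gj (∑-mono-≤ (f ∘ suc) (g ∘ suc) (f≤g ∘ suc))
∑-mono-< {suc n} f g f≤g (suc j) fj<gj = +-mono-≤-< (f≤g zero) (∑-mono-< (f ∘ suc) (g ∘ suc) (f≤g ∘ suc) j fj<gj)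

χ : ∀ {n} → Subset n → Fin n → ℕ
χ T i = if lookup T i then 1 else 0

∣p∣≡∑χ : ∀ {n} (T : Subset n) → ∣ T ∣ ≡ sum (χ T)
∣p∣≡∑χ []          = refl
∣p∣≡∑χ (true ∷ T)  = cong suc (∣p∣≡∑χ T)
∣p∣≡∑χ (false ∷ T) = ∣p∣≡∑χ T

χ-∈ : ∀ {n} {T : Subset n} {i} → i ∈ T → χ T i ≡ 1
χ-∈ {T = T} {i} i∈T rewrite []=⇒lookup i∈T = refl

χ-∉ : ∀ {n} {T : Subset n} {i} → i ∉ T → χ T i ≡ 0
χ-∉ {T = T} {i} i∉T with lookup T i in eq
... | true  = contradiction (lookup⇒[]= i T eq) i∉T
... | false = refl

χ≤1 : ∀ {n} (T : Subset n) i → χ T i ≤ 1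
χ≤1 T i with lookup T i
... | true  = ≤-refl
... | false = z≤n

module _ {n} {G : Graph n} (M : PerfectMatching G) where

  pairCount : Subset n → Fin n → ℕ
  pairCount T i = χ T i + χ T (partner M i)

  ∑pairCount : (T : Subset n) → sum (pairCount T) ≡ ∣ T ∣ + ∣ T ∣
  ∑pairCount T = trans (∑-distrib-+ (χ T) (χ T ∘ partner M))
    (sym (cong₂ _+_ (∣p∣≡∑χ T) (trans (∣p∣≡∑χ T) (sum-permute (χ T) matchingPermutation))))
    where
    matchingPermutation : Permutation n n
    matchingPermutation = permutation (partner M) (partner M) (partner-invol M) (partner-invol M)

  pairCount≤1 : ∀ {T} → Independent G (_∈ T) → ∀ i → pairCount T i ≤ 1
  pairCount≤1 {T} indT i with i ∈? T
  ... | no i∉T = subst (λ k → k + χ T (partner M i) ≤ 1) (sym (χ-∉ i∉T)) (χ≤1 T (partner M i))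
  ... | yes i∈T = subst (_≤ 1) (sym (cong₂ _+_ (χ-∈ i∈T) (χ-∉ pi∉T))) ≤-refl
    where
    pi∉T : partner M i ∉ T
    pi∉T pi∈T = indT i (partner M i) i∈T pi∈T (partner-adj M i)

  1≤pairCount : ∀ {T} i → i ∈ T ⊎ partner M i ∈ T → 1 ≤ pairCount T i
  1≤pairCount {T} i (inj₁ i∈T)  = subst (λ k → 1 ≤ k + χ T (partner M i)) (sym (χ-∈ i∈T)) (m≤m+n 1 _)
  1≤pairCount {T} i (inj₂ pi∈T) = subst (λ k → 1 ≤ χ T i + k) (sym (χ-∈ pi∈T)) (m≤n+m 1 _)

  -- Summing pairCount S ≤ 1 ≤ pairCount T over all vertices, an edge of M
  -- missed by S would give ∣ S ∣ < ∣ T ∣.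
  maximumIndependent-covers-matching :
    (T : Subset n) → Independent G (_∈ T) → (∀ i → i ∈ T ⊎ partner M i ∈ T) →
    ∀ {S} → MaximumIndependent G S → ∀ v → v ∉ S → partner M v ∈ S
  maximumIndependent-covers-matching T indT coverT {S} (indS , maxS) v v∉S with partner M v ∈? S
  ... | yes pv∈S = pv∈S
  ... | no  pv∉S = contradiction (+-mono-≤ (maxS T indT) (maxS T indT)) (<⇒≱ 2∣S∣<2∣T∣)
    where
    pairS≤pairT : ∀ i → pairCount S i ≤ pairCount T i
    pairS≤pairT i = ≤-trans (pairCount≤1 indS i) (1≤pairCount i (coverT i))
    pairS<pairT : pairCount S v < pairCount T v
    pairS<pairT = subst (_< pairCount T v) (sym (cong₂ _+_ (χ-∉ v∉S) (χ-∉ pv∉S))) (1≤pairCount v (coverT v))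
    2∣S∣<2∣T∣ : ∣ S ∣ + ∣ S ∣ < ∣ T ∣ + ∣ T ∣
    2∣S∣<2∣T∣ = subst₂ _<_ (∑pairCount S) (∑pairCount T)
      (∑-mono-< (pairCount S) (pairCount T) pairS≤pairT v pairS<pairT)

module _ {n} {G : Graph n} (bip : Bipartite G) where

  private
    c = proj₁ bip

  colourClass : Subset n
  colourClass = tabulate c

  c≡true⇒∈colourClass : ∀ {u} → c u ≡ true → u ∈ colourClass
  c≡true⇒∈colourClass {u} cu≡true = lookup⇒[]= u colourClass (trans (lookup∘tabulate c u) cu≡true)

  ∈colourClass⇒c≡true : ∀ {u} → u ∈ colourClass → c u ≡ true
  ∈colourClass⇒c≡true {u} u∈C = trans (sym (lookup∘tabulate c u)) ([]=⇒lookup u∈C)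

  colourClass-independent : Independent G (_∈ colourClass)
  colourClass-independent u w u∈C w∈C adj = proj₂ bip u w adj
    (trans (∈colourClass⇒c≡true u∈C) (sym (∈colourClass⇒c≡true w∈C)))

  colourClass-covers-edge : ∀ {u w} → Adj G u w → u ∈ colourClass ⊎ w ∈ colourClass
  colourClass-covers-edge {u} {w} adj with c u in cu | c w in cw
  ... | true  | _     = inj₁ (c≡true⇒∈colourClass cu)
  ... | false | true  = inj₂ (c≡true⇒∈colourClass cw)
  ... | false | false = contradiction (trans cu (sym cw)) (proj₂ bip u w adj)

  bipartite-maximumIndependent-covers-matching :
    (M : PerfectMatching G) → ∀ {S} → MaximumIndependent G S → ∀ v → v ∉ S → partner M v ∈ S
  bipartite-maximumIndependent-covers-matching M =
    maximumIndependent-covers-matching M colourClass colourClass-independent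
      (λ i → colourClass-covers-edge (partner-adj M i))

module _ {n} {G : Graph n} where

  WalkIn-start : ∀ {Y u v} → WalkIn G Y u v → Y u
  WalkIn-start (here Yu)     = Yu
  WalkIn-start (step Yu _ _) = Yu

  WalkIn-map : ∀ {A B u v} → (∀ w → A w → B w) → WalkIn G A u v → WalkIn G B u v
  WalkIn-map A⊆B (here Au)          = here (A⊆B _ Au)
  WalkIn-map A⊆B (step Au adj walk) = step (A⊆B _ Au) adj (WalkIn-map A⊆B walk)

  _++ᵂ_ : ∀ {Y u v w} → WalkIn G Y u v → WalkIn G Y v w → WalkIn G Y u w
  here _           ++ᵂ walk′ = walk′
  step Yu adj walk ++ᵂ walk′ = step Yu adj (walk ++ᵂ walk′)

  WalkIn-reverse : ∀ {Y u v} → WalkIn G Y u v → WalkIn G Y v u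
  WalkIn-reverse (here Yu)          = here Yu
  WalkIn-reverse (step Yu adj walk) =
    WalkIn-reverse walk ++ᵂ step (WalkIn-start walk) (symAdj G adj) (here Yu)

  ConnectedInduced-extend : ∀ {Y Z} → ConnectedInduced G Y → (∀ w → Y w → Z w) →
    (∀ z → Z z → ∃ λ y → Y y × WalkIn G Z z y) → ConnectedInduced G Z
  ConnectedInduced-extend connY Y⊆Z reachY u v Zu Zv
    with reachY u Zu | reachY v Zv
  ... | y , Yy , u⇝y | y′ , Yy′ , v⇝y′ =
    u⇝y ++ᵂ (WalkIn-map Y⊆Z (connY y y′ Yy Yy′) ++ᵂ WalkIn-reverse v⇝y′)

module _ {n} {G : Graph n} (bip : Bipartite G) {A B : VSet n}
  (indA : Independent G A) (indB : Independent G B) where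

  private
    c = proj₁ bip

  -- Every edge of G[A ∪ B] joins A to B, so colours alternate between A and B.
  SideOf : Fin n → Fin n → Set
  SideOf u w = (A w → c w ≡ c u) × (B w → c w ≢ c u)

  SideOf-step : ∀ {u w w′} → (A ∪ B) w → Adj G w w′ → SideOf u w → SideOf u w′
  SideOf-step {w = w} {w′} (inj₁ Aw) adj (onA , _) =
    (λ Aw′ → contradiction adj (indA w w′ Aw Aw′)) ,
    (λ _ cw′≡cu → proj₂ bip w w′ adj (trans (onA Aw) (sym cw′≡cu)))
  SideOf-step {w = w} {w′} (inj₂ Bw) adj (_ , onB) =
    (λ _ → ≢-≢⇒≡ (≢-sym (proj₂ bip w w′ adj)) (onB Bw)) ,
    (λ Bw′ → contradiction adj (indB w w′ Bw Bw′))

  SideOf-walk : ∀ {u w v} → WalkIn G (A ∪ B) w v → SideOf u w → SideOf u v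
  SideOf-walk (here _)           side = side
  SideOf-walk (step ABw adj walk) side = SideOf-walk walk (SideOf-step ABw adj side)

  walk-in-union-preserves-colour : (∀ v → A v → ¬ B v) →
    ∀ {u v} → WalkIn G (A ∪ B) u v → A u → A v → c v ≡ c u
  walk-in-union-preserves-colour A∩B≡∅ walk Au Av =
    proj₁ (SideOf-walk walk ((λ _ → refl) , λ Bu → contradiction Bu (A∩B≡∅ _ Au))) Av

module X¹-properties {n} (G : Graph n) (bip : Bipartite G) (M : PerfectMatching G)
  (S : Subset n) (maxS : MaximumIndependent G S) (X : VSet n) (indX : Independent G X)
  (X∩S≡∅ : ∀ v → X v → v ∉ S) (connX : ConnectedInduced G (X ∪ Matched M X)) where

  private
    c = proj₁ bip
    p = partner M

  Matched-X⊆S : ∀ w → Matched M X w → w ∈ S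
  Matched-X⊆S w (x , Xx , refl) =
    bipartite-maximumIndependent-covers-matching bip M maxS x (X∩S≡∅ x Xx)

  X-monochromatic : ∀ x x′ → X x → X x′ → c x′ ≡ c x
  X-monochromatic x x′ Xx Xx′ =
    walk-in-union-preserves-colour bip indX MX-independent
      (λ v Xv MXv → X∩S≡∅ v Xv (Matched-X⊆S v MXv))
      (connX x x′ (inj₁ Xx) (inj₁ Xx′)) Xx Xx′
    where
    MX-independent : Independent G (Matched M X)
    MX-independent u w MXu MXw = proj₁ maxS u w (Matched-X⊆S u MXu) (Matched-X⊆S w MXw)

  -- For a new vertex p y of X¹, with y adjacent to x ∈ X:
  -- c (p y) ≢ c y ≢ c x, hence c (p y) ≡ c x.
  X¹-colour : ∀ z → X¹ M S X z → ∃ λ x → X x × c z ≡ c x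
  X¹-colour z (inj₁ Xz) = z , Xz , refl
  X¹-colour z (inj₂ (y , (((x , Xx , y-x) , _) , _) , refl)) =
    x , Xx , ≢-≢⇒≡ (≢-sym (proj₂ bip y (p y) (partner-adj M y))) (proj₂ bip y x y-x)

  X¹-independent : Independent G (X¹ M S X)
  X¹-independent u v X¹u X¹v adj with X¹-colour u X¹u | X¹-colour v X¹v
  ... | xu , Xxu , cu≡cxu | xv , Xxv , cv≡cxv =
    proj₂ bip u v adj (trans cu≡cxu (trans (X-monochromatic xv xu Xxv Xxu) (sym cv≡cxv)))

  X¹∪MX¹ : VSet n
  X¹∪MX¹ = X¹ M S X ∪ Matched M (X¹ M S X)

  X∪MX⊆X¹∪MX¹ : ∀ w → (X ∪ Matched M X) w → X¹∪MX¹ w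
  X∪MX⊆X¹∪MX¹ w (inj₁ Xw)              = inj₁ (inj₁ Xw)
  X∪MX⊆X¹∪MX¹ w (inj₂ (x , Xx , w≡px)) = inj₂ (x , inj₁ Xx , w≡px)

  -- The vertices p y ∈ X¹ and y = p (p y) ∈ M(X¹), for y ∈ (N(X) ∩ S) − M(X),
  -- reach X along p y — y — x with x a neighbour of y in X.
  X¹∪MX¹-reaches-X∪MX : ∀ z → X¹∪MX¹ z → ∃ λ w → (X ∪ Matched M X) w × WalkIn G X¹∪MX¹ z w
  X¹∪MX¹-reaches-X∪MX z Zz@(inj₁ (inj₁ Xz))          = z , inj₁ Xz , here Zz
  X¹∪MX¹-reaches-X∪MX z Zz@(inj₂ (x , inj₁ Xx , z≡px)) = z , inj₂ (x , Xx , z≡px) , here Zz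
  X¹∪MX¹-reaches-X∪MX z Zz@(inj₁ (inj₂ (y , Dy@(((x , Xx , y-x) , _) , _) , refl))) =
    x , inj₁ Xx ,
    step Zz (symAdj G (partner-adj M y)) (step Zy y-x (here (inj₁ (inj₁ Xx))))
    where
    Zy : X¹∪MX¹ y
    Zy = inj₂ (p y , inj₂ (y , Dy , refl) , sym (partner-invol M y))
  X¹∪MX¹-reaches-X∪MX z Zz@(inj₂ (_ , inj₂ (y , (((x , Xx , y-x) , _) , _) , refl) , refl)) =
    x , inj₁ Xx , step Zz (subst (λ t → Adj G t x) (sym (partner-invol M y)) y-x) (here (inj₁ (inj₁ Xx)))

  X¹-connected : ConnectedInduced G X¹∪MX¹
  X¹-connected = ConnectedInduced-extend connX X∪MX⊆X¹∪MX¹ X¹∪MX¹-reaches-X∪MX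

mainTheorem4 : ∀ {n} (G : Graph n) → Bipartite G → (M : PerfectMatching G) → (S : Subset n) → MaximumIndependent G S → (X : VSet n) → Independent G X → (∀ v → X v → v ∉ S) → ConnectedInduced G (X ∪ Matched M X) → Independent G (X¹ M S X) × ConnectedInduced G (X¹ M S X ∪ Matched M (X¹ M S X))
mainTheorem4 G bip M S maxS X indX X∩S≡∅ connX = X¹-independent , X¹-connected
  where open X¹-properties G bip M S maxS X indX X∩S≡∅ connX
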